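{- If $G$ is a digraph with $\delta^-(G)\ge 1$ such that $\rho^{\rm o}(G)=\gamma_t(G)$, then $\gamma_t(G\times H)=\gamma_t(G)\gamma_t(H)$ for every digraph $H$ with $\delta^-(H)\ge 1$.
   Context: All digraphs are finite, and their arc relation is irreflexive (no loops). For a digraph $D$ and vertex $v$, $N^+_D(v)$ is the set of out-neighbors and $N^-_D(v)$ the set of in-neighbors of $v$; $\delta^-(D)$ is the minimum in-degree. If $\delta^-(D)\ge1$, a set $S$ is a total dominating set if $\bigcup_{v\in S}N^+_D(v)=V(D)$, and $\gamma_t(D)$ is the minimum size of a total dominating set. A set $B\subseteq V(D)$ is an open packing if $N^-_D(u)\cap N^-_D(v)=\emptyset$ for all distinct $u,v\in B$; $\rho^{\rm o}(D)$ is the maximum size of an open packing. The direct product $G\times H$ has vertex set $V(G)\times V(H)$, with an arc from $(g_1,h_1)$ to $(g_2,h_2)$ iff $g_1g_2\in A(G)$ and $h_1h_2\in A(H)$. -}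

module Defs where

open import Data.Nat using (ℕ; _≤_; _*_)
open import Data.Fin using (Fin; combine; remQuot)
open import Data.Fin.Subset using (Subset; _∈_; ∣_∣)
open import Data.Product using (Σ; ∃; ∃-syntax; _×_; _,_; proj₁; proj₂)
open import Relation.Nullary using (¬_)
open import Relation.Binary.PropositionalEquality using (_≡_)

record Digraph (n : ℕ) : Set₁ where
  field
    Arc   : Fin n → Fin n → Set
    irrefl : ∀ v → ¬ Arc v v
open Digraph public

MinInDegPos : ∀ {n} → Digraph n → Set
MinInDegPos {n} D = ∀ (v : Fin n) → ∃[ u ] Arc D u v

IsTDS : ∀ {n} → Digraph n → Subset n → Set
IsTDS {n} D S = ∀ (v : Fin n) → ∃[ u ] (u ∈ S × Arc D u v)

IsTotalDomNumber : ∀ {n} → Digraph n → ℕ → Set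
IsTotalDomNumber D k =
  (∃[ S ] (IsTDS D S × ∣ S ∣ ≡ k)) × (∀ S → IsTDS D S → k ≤ ∣ S ∣)

IsOpenPacking : ∀ {n} → Digraph n → Subset n → Set
IsOpenPacking {n} D B =
  ∀ (u v : Fin n) → u ∈ B → v ∈ B → ¬ (u ≡ v) →
    ∀ (w : Fin n) → ¬ (Arc D w u × Arc D w v)

IsOpenPackingNumber : ∀ {n} → Digraph n → ℕ → Set
IsOpenPackingNumber D k =
  (∃[ B ] (IsOpenPacking D B × ∣ B ∣ ≡ k)) × (∀ B → IsOpenPacking D B → ∣ B ∣ ≤ k)

-- Direct product G × H on Fin (n * m); vertex (g , h) is encoded as combine g h.
_×ᴰ_ : ∀ {n m} → Digraph n → Digraph m → Digraph (n * m)
_×ᴰ_ {n} {m} G H = record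
  { Arc = λ x y →
      Arc G (proj₁ (remQuot {n} m x)) (proj₁ (remQuot {n} m y)) ×
      Arc H (proj₂ (remQuot {n} m x)) (proj₂ (remQuot {n} m y))
  ; irrefl = λ x a → irrefl G (proj₁ (remQuot {n} m x)) (proj₁ a)
  }

-- A total dominating set of G × H is built as S × T from total dominating sets S of G and T
-- of H, so γₜ(G × H) ≤ γₜ(G) γₜ(H). Conversely, let D totally dominate G × H and let B be an
-- open packing of G. For b ∈ B, the H-coordinates of the vertices of D dominating the fibre
-- {b} × V(H) form a total dominating set of H, so there are at least γₜ(H) of them; and since
-- the in-neighbourhoods of distinct members of B are disjoint, the dominators used by different
-- fibres are different vertices of D. Hence ρᵒ(G) γₜ(H) ≤ |D|, and ρᵒ(G) = γₜ(G) closes the gap.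
module Submission where

open import Defs
open import Data.Nat using (ℕ; suc; _+_; _*_; _≤_; z≤n)
open import Data.Nat.Properties using (+-mono-≤; ≤-<-trans; ≤-reflexive; ≤-trans)
open import Data.Fin using (Fin; zero; suc; combine; quotient; remainder; _↑ˡ_; _↑ʳ_)
open import Data.Fin.Properties using (_≟_; any?; suc-injective; combine-remQuot; remQuot-combine)
open import Data.Fin.Subset using (Subset; _∈_; ∣_∣; ⊥; inside; outside; _-_)
open import Data.Fin.Subset.Properties
  using (∉⊥; ∣⊥∣≡0; x∈p⇒p-x⊂p; x∈p∧x≢y⇒x∈p-y; p⊂q⇒∣p∣<∣q∣)
open import Data.Vec using ([]; _∷_; _++_; lookup; tabulate; here; there)
open import Data.Vec.Properties using (lookup-++ˡ; lookup-++ʳ; lookup∘tabulate; []=⇒lookup; lookup⇒[]=)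
open import Data.Product using (∃-syntax; _×_; _,_; proj₁; proj₂)
open import Function using (_∘_; const)
open import Relation.Nullary using (does; yes; no; contradiction)
open import Relation.Nullary.Decidable using (dec-true)
open import Relation.Binary.PropositionalEquality using (_≡_; refl; sym; trans; cong; cong₂; subst)

private
  variable
    a c n m l : ℕ

∈-++⁺ˡ : {p : Subset a} {q : Subset c} {i : Fin a} → i ∈ p → i ↑ˡ c ∈ p ++ q
∈-++⁺ˡ {p = p} {q} {i} i∈p = lookup⇒[]= _ (p ++ q) (trans (lookup-++ˡ p q i) ([]=⇒lookup i∈p))

∈-++⁻ˡ : (p : Subset a) {q : Subset c} (i : Fin a) → i ↑ˡ c ∈ p ++ q → i ∈ p
∈-++⁻ˡ p {q} i i∈ = lookup⇒[]= i p (trans (sym (lookup-++ˡ p q i)) ([]=⇒lookup i∈))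

∈-++⁺ʳ : (p : Subset a) {q : Subset c} {j : Fin c} → j ∈ q → a ↑ʳ j ∈ p ++ q
∈-++⁺ʳ p {q} {j} j∈q = lookup⇒[]= _ (p ++ q) (trans (lookup-++ʳ p q j) ([]=⇒lookup j∈q))

∈-++⁻ʳ : (p : Subset a) {q : Subset c} (j : Fin c) → a ↑ʳ j ∈ p ++ q → j ∈ q
∈-++⁻ʳ p {q} j j∈ = lookup⇒[]= j q (trans (sym (lookup-++ʳ p q j)) ([]=⇒lookup j∈))

∣p++q∣≡∣p∣+∣q∣ : (p : Subset a) (q : Subset c) → ∣ p ++ q ∣ ≡ ∣ p ∣ + ∣ q ∣
∣p++q∣≡∣p∣+∣q∣ []            q = refl
∣p++q∣≡∣p∣+∣q∣ (inside  ∷ p) q = cong suc (∣p++q∣≡∣p∣+∣q∣ p q)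
∣p++q∣≡∣p∣+∣q∣ (outside ∷ p) q = ∣p++q∣≡∣p∣+∣q∣ p q

∣⊥++q∣≡∣q∣ : (q : Subset c) → ∣ ⊥ {a} ++ q ∣ ≡ ∣ q ∣
∣⊥++q∣≡∣q∣ {a = a} q = trans (∣p++q∣≡∣p∣+∣q∣ (⊥ {a}) q) (cong (_+ ∣ q ∣) (∣⊥∣≡0 a))

-- B ⋉ T = { combine b h ∣ b ∈ B, h ∈ T b }; Fin (n * m) is laid out as n blocks of size m.
infixr 7 _⋉_
_⋉_ : Subset n → (Fin n → Subset m) → Subset (n * m)
[]            ⋉ T = []
(inside  ∷ B) ⋉ T = T zero ++ B ⋉ (T ∘ suc)
(outside ∷ B) ⋉ T = ⊥ ++ B ⋉ (T ∘ suc)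

∈-⋉⁺ : {B : Subset n} {T : Fin n → Subset m} {b : Fin n} {h : Fin m} →
       b ∈ B → h ∈ T b → combine b h ∈ B ⋉ T
∈-⋉⁺ {B = inside  ∷ B} {b = zero}  _          h∈T = ∈-++⁺ˡ h∈T
∈-⋉⁺ {B = inside  ∷ B} {b = suc b} (there b∈) h∈T = ∈-++⁺ʳ _ (∈-⋉⁺ b∈ h∈T)
∈-⋉⁺ {B = outside ∷ B} {b = suc b} (there b∈) h∈T = ∈-++⁺ʳ ⊥ (∈-⋉⁺ b∈ h∈T)

∈-⋉⁻ : (B : Subset n) {T : Fin n → Subset m} (b : Fin n) {h : Fin m} →
       combine b h ∈ B ⋉ T → b ∈ B × h ∈ T b
∈-⋉⁻ (inside  ∷ B) zero    h∈ = here , ∈-++⁻ˡ _ _ h∈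
∈-⋉⁻ (outside ∷ B) zero    h∈ = contradiction (∈-++⁻ˡ ⊥ _ h∈) ∉⊥
∈-⋉⁻ (inside  ∷ B) (suc b) x∈ with ∈-⋉⁻ B b (∈-++⁻ʳ _ _ x∈)
... | b∈B , h∈T = there b∈B , h∈T
∈-⋉⁻ (outside ∷ B) (suc b) x∈ with ∈-⋉⁻ B b (∈-++⁻ʳ ⊥ _ x∈)
... | b∈B , h∈T = there b∈B , h∈T

∈-⋉⁻-quotRem : (B : Subset n) {T : Fin n → Subset m} {x : Fin (n * m)} → x ∈ B ⋉ T →
               quotient m x ∈ B × remainder {n} m x ∈ T (quotient m x)
∈-⋉⁻-quotRem {n = n} {m = m} B {T} {x} x∈ =
  ∈-⋉⁻ B (quotient m x) (subst (_∈ B ⋉ T) (sym (combine-remQuot {n} m x)) x∈)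

∣B∣*l≤∣B⋉T∣ : (B : Subset n) {T : Fin n → Subset m} →
              (∀ {b} → b ∈ B → l ≤ ∣ T b ∣) → ∣ B ∣ * l ≤ ∣ B ⋉ T ∣
∣B∣*l≤∣B⋉T∣ []            l≤T = z≤n
∣B∣*l≤∣B⋉T∣ (inside  ∷ B) {T} l≤T =
  ≤-trans (+-mono-≤ (l≤T here) (∣B∣*l≤∣B⋉T∣ B (λ b∈ → l≤T (there b∈))))
          (≤-reflexive (sym (∣p++q∣≡∣p∣+∣q∣ (T zero) _)))
∣B∣*l≤∣B⋉T∣ {m = m} (outside ∷ B) {T} l≤T =
  ≤-trans (∣B∣*l≤∣B⋉T∣ B (λ b∈ → l≤T (there b∈)))
          (≤-reflexive (sym (∣⊥++q∣≡∣q∣ {a = m} (B ⋉ (T ∘ suc)))))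

∣B⋉T∣≡∣B∣*∣T∣ : (B : Subset n) (T : Subset m) → ∣ B ⋉ const T ∣ ≡ ∣ B ∣ * ∣ T ∣
∣B⋉T∣≡∣B∣*∣T∣ []            T = refl
∣B⋉T∣≡∣B∣*∣T∣ (inside  ∷ B) T =
  trans (∣p++q∣≡∣p∣+∣q∣ T _) (cong (∣ T ∣ +_) (∣B⋉T∣≡∣B∣*∣T∣ B T))
∣B⋉T∣≡∣B∣*∣T∣ {m = m} (outside ∷ B) T =
  trans (∣⊥++q∣≡∣q∣ {a = m} (B ⋉ const T)) (∣B⋉T∣≡∣B∣*∣T∣ B T)

image : (Fin a → Fin c) → Subset c
image f = tabulate λ y → does (any? λ x → f x ≟ y)

∈-image⁺ : (f : Fin a → Fin c) (x : Fin a) → f x ∈ image f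
∈-image⁺ f x = lookup⇒[]= (f x) (image f)
  (trans (lookup∘tabulate _ (f x)) (dec-true (any? λ x′ → f x′ ≟ f x) (x , refl)))

∈-image⁻ : (f : Fin a → Fin c) {y : Fin c} → y ∈ image f → ∃[ x ] f x ≡ y
∈-image⁻ f {y} y∈ with any? (λ x → f x ≟ y) | trans (sym (lookup∘tabulate _ y)) ([]=⇒lookup y∈)
... | yes fx≡y | _  = fx≡y
... | no  _    | ()

∣p∣≤∣q∣-by-injection : (p : Subset a) {q : Subset c} (R : Fin a → Fin c → Set) →
  (∀ {i} → i ∈ p → ∃[ j ] (j ∈ q × R i j)) →
  (∀ {i i′ j} → i ∈ p → i′ ∈ p → R i j → R i′ j → i ≡ i′) →
  ∣ p ∣ ≤ ∣ q ∣
∣p∣≤∣q∣-by-injection []            R total injective = z≤n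
∣p∣≤∣q∣-by-injection (outside ∷ p) R total injective =
  ∣p∣≤∣q∣-by-injection p (R ∘ suc) (λ i∈ → total (there i∈))
    (λ i∈ i′∈ r r′ → suc-injective (injective (there i∈) (there i′∈) r r′))
∣p∣≤∣q∣-by-injection (inside  ∷ p) {q} R total injective with total here
... | j , j∈q , Rj =
  ≤-<-trans (∣p∣≤∣q∣-by-injection p {q - j} (R ∘ suc) total′
              (λ i∈ i′∈ r r′ → suc-injective (injective (there i∈) (there i′∈) r r′)))
            (p⊂q⇒∣p∣<∣q∣ (x∈p⇒p-x⊂p j∈q))
  where
  total′ : ∀ {i} → i ∈ p → ∃[ j′ ] (j′ ∈ q - j × R (suc i) j′)
  total′ i∈ with total (there i∈)
  ... | j′ , j′∈q , Rj′ =
    j′ , x∈p∧x≢y⇒x∈p-y j′∈q (λ { refl → contradiction (injective (there i∈) here Rj′ Rj) λ () }) , Rj′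

quotient-combine : (g : Fin n) (h : Fin m) → quotient m (combine g h) ≡ g
quotient-combine {n} {m} g h = cong proj₁ (remQuot-combine {n} {m} g h)

remainder-combine : (g : Fin n) (h : Fin m) → remainder {n} m (combine g h) ≡ h
remainder-combine {n} {m} g h = cong proj₂ (remQuot-combine {n} {m} g h)

module _ {n m : ℕ} (G : Digraph n) (H : Digraph m) where

  private
    π₁ : Fin (n * m) → Fin n
    π₁ = quotient m

    π₂ : Fin (n * m) → Fin m
    π₂ = remainder {n} m

  ≡-by-quotRem : {x y : Fin (n * m)} → π₁ x ≡ π₁ y → π₂ x ≡ π₂ y → x ≡ y
  ≡-by-quotRem {x} {y} π₁≡ π₂≡ =
    trans (sym (combine-remQuot {n} m x)) (trans (cong₂ combine π₁≡ π₂≡) (combine-remQuot {n} m y))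

  ×ᴰ-arc⁺ : {g : Fin n} {h : Fin m} {y : Fin (n * m)} →
            Arc G g (π₁ y) → Arc H h (π₂ y) → Arc (G ×ᴰ H) (combine g h) y
  ×ᴰ-arc⁺ {g} {h} g→ h→ =
    subst (λ g′ → Arc G g′ _) (sym (quotient-combine g h)) g→ ,
    subst (λ h′ → Arc H h′ _) (sym (remainder-combine g h)) h→

  ×ᴰ-arc⁻ : {x : Fin (n * m)} {g : Fin n} {h : Fin m} →
            Arc (G ×ᴰ H) x (combine g h) → Arc G (π₁ x) g × Arc H (π₂ x) h
  ×ᴰ-arc⁻ {g = g} {h} (g→ , h→) =
    subst (Arc G _) (quotient-combine g h) g→ , subst (Arc H _) (remainder-combine g h) h→

  ⋉-isTDS : {S : Subset n} {T : Subset m} → IsTDS G S → IsTDS H T → IsTDS (G ×ᴰ H) (S ⋉ const T)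
  ⋉-isTDS tdsS tdsT v with tdsS (π₁ v) | tdsT (π₂ v)
  ... | g , g∈S , g→ | h , h∈T , h→ = combine g h , ∈-⋉⁺ g∈S h∈T , ×ᴰ-arc⁺ g→ h→

  ∣openPacking∣*l≤∣tds∣ : {B : Subset n} {D : Subset (n * m)} {l : ℕ} →
    IsOpenPacking G B → (∀ T → IsTDS H T → l ≤ ∣ T ∣) → IsTDS (G ×ᴰ H) D → ∣ B ∣ * l ≤ ∣ D ∣
  ∣openPacking∣*l≤∣tds∣ {B} {D} packing γₜ≥l tdsD =
    ≤-trans (∣B∣*l≤∣B⋉T∣ B (λ {b} _ → γₜ≥l (T b) (T-isTDS b)))
            (∣p∣≤∣q∣-by-injection (B ⋉ T) R R-total R-injective)
    where
    dom : Fin (n * m) → Fin (n * m)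
    dom x = proj₁ (tdsD x)

    dom∈D : ∀ x → dom x ∈ D
    dom∈D x = proj₁ (proj₂ (tdsD x))

    dom→ : ∀ x → Arc (G ×ᴰ H) (dom x) x
    dom→ x = proj₂ (proj₂ (tdsD x))

    T : Fin n → Subset m
    T b = image (λ h → π₂ (dom (combine b h)))

    T-isTDS : ∀ b → IsTDS H (T b)
    T-isTDS b h = π₂ (dom (combine b h)) , ∈-image⁺ _ h , proj₂ (×ᴰ-arc⁻ (dom→ (combine b h)))

    R : Fin (n * m) → Fin (n * m) → Set
    R x d = π₂ d ≡ π₂ x × Arc G (π₁ d) (π₁ x)

    R-total : ∀ {x} → x ∈ B ⋉ T → ∃[ d ] (d ∈ D × R x d)
    R-total {x} x∈ with ∈-image⁻ _ (proj₂ (∈-⋉⁻-quotRem B x∈))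
    ... | h , π₂≡ = dom (combine (π₁ x) h) , dom∈D _ , π₂≡ , proj₁ (×ᴰ-arc⁻ (dom→ _))

    R-injective : ∀ {x y d} → x ∈ B ⋉ T → y ∈ B ⋉ T → R x d → R y d → x ≡ y
    R-injective {x} {y} {d} x∈ y∈ (π₂x≡ , d→x) (π₂y≡ , d→y) =
      ≡-by-quotRem same-fibre (trans (sym π₂x≡) π₂y≡)
      where
      same-fibre : π₁ x ≡ π₁ y
      same-fibre with π₁ x ≟ π₁ y
      ... | yes π₁≡ = π₁≡
      ... | no  π₁≢ = contradiction (d→x , d→y)
        (packing _ _ (proj₁ (∈-⋉⁻-quotRem B x∈)) (proj₁ (∈-⋉⁻-quotRem B y∈)) π₁≢ (π₁ d))

-- The hypotheses δ⁻ ≥ 1 are implied by the existence of total dominating sets.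
theorem1p4 : ∀ {n m : ℕ} (G : Digraph n) (H : Digraph m) (k l : ℕ) →
    MinInDegPos G → MinInDegPos H →
    IsTotalDomNumber G k → IsOpenPackingNumber G k →
    IsTotalDomNumber H l →
    IsTotalDomNumber (G ×ᴰ H) (k * l)
theorem1p4 G H k l _ _ ((S , tdsS , ∣S∣≡k) , _) ((B , packing , ∣B∣≡k) , _) ((T , tdsT , ∣T∣≡l) , γₜH≥l) =
  (S ⋉ const T , ⋉-isTDS G H tdsS tdsT , size) ,
  λ D tdsD → subst (λ b → b * l ≤ ∣ D ∣) ∣B∣≡k (∣openPacking∣*l≤∣tds∣ G H packing γₜH≥l tdsD)
  where
  size : ∣ S ⋉ const T ∣ ≡ k * l
  size = trans (∣B⋉T∣≡∣B∣*∣T∣ S T) (cong₂ _*_ ∣S∣≡k ∣T∣≡l)
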